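{- Let $S=[s_{k\ell}]$ be the Seidel matrix of a tournament $T$, and suppose $S$ is invertible. Let $i\neq j$ be players with $s_{ij}=1$, let $T'$ be the $(i,j)$-reversal of $T$, and let $S'$ be the Seidel matrix of $T'$. Then \[\det S'=\det S\cdot(1+2S^{ -1}_{ij})^2,\] where $S^{ -1}_{ij}$ denotes the $(i,j)$-entry of $S^{ -1}$. In particular: (a) $\det S'>\det S$ if $S^{ -1}_{ij}>0$ or $S^{ -1}_{ij}<-1$; (b) $\det S'=\det S$ if $S^{ -1}_{ij}\in\{0,-1\}$; (c) $\det S'<\det S$ if $-1<S^{ -1}_{ij}<0$.
   Context: A tournament of order $n$ is a digraph on $\{1,\dots,n\}$ with exactly one of the arcs $ij$, $ji$ for each pair $i\ne j$. Its Seidel matrix $S=[s_{ij}]$ is the $n\times n$ skew-symmetric matrix with zero diagonal, $s_{ij}=1$ if $ij$ is an arc and $s_{ij}=-1$ otherwise. The $(i,j)$-reversal of $T$ is the tournament obtained from $T$ by reversing the orientation of the single edge joining $i$ and $j$, keeping all other arcs. -}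

module Defs where

open import Data.Nat using (ℕ; zero; suc)
open import Data.Fin using (Fin; zero; suc; punchIn; _≟_)
open import Data.Bool using (Bool; true; false; not; if_then_else_; _∧_; _∨_)
open import Data.Rational using (ℚ; 0ℚ; 1ℚ; -_; _+_; _*_)
open import Relation.Nullary.Decidable using (⌊_⌋; does)
open import Relation.Binary.PropositionalEquality using (_≡_; _≢_)
open import Data.Product using (_×_)

Mat : ℕ → Set
Mat n = Fin n → Fin n → ℚ

IsTournament : {n : ℕ} → (Fin n → Fin n → Bool) → Set
IsTournament {n} A = ((i : Fin n) → A i i ≡ false)
                   × ((i j : Fin n) → i ≢ j → A i j ≡ not (A j i))

seidel : {n : ℕ} → (Fin n → Fin n → Bool) → Mat n
seidel A k l = if does (k ≟ l) then 0ℚ else (if A k l then 1ℚ else - 1ℚ)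

reversal : {n : ℕ} → (Fin n → Fin n → Bool) → Fin n → Fin n → (Fin n → Fin n → Bool)
reversal A i j k l =
  if (does (k ≟ i) ∧ does (l ≟ j)) ∨ (does (k ≟ j) ∧ does (l ≟ i))
  then not (A k l) else A k l

sumFin : {n : ℕ} → (Fin n → ℚ) → ℚ
sumFin {zero} f = 0ℚ
sumFin {suc n} f = f zero + sumFin (λ k → f (suc k))

sgn : ℕ → ℚ
sgn zero = 1ℚ
sgn (suc k) = - sgn k

det : {n : ℕ} → Mat n → ℚ
det {zero} M = 1ℚ
det {suc n} M = sumFin (λ k → sgn (Data.Fin.toℕ k) * (M zero k * det (λ r c → M (suc r) (punchIn k c))))

_⊗_ : {n : ℕ} → Mat n → Mat n → Mat n
(M ⊗ N) i j = sumFin (λ k → M i k * N k j)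

idMat : {n : ℕ} → Mat n
idMat i j = if does (i ≟ j) then 1ℚ else 0ℚ

IsInverse : {n : ℕ} → Mat n → Mat n → Set
IsInverse {n} M B = ((i j : Fin n) → (M ⊗ B) i j ≡ idMat i j)
                  × ((i j : Fin n) → (B ⊗ M) i j ≡ idMat i j)

-- Reversing the arc ij changes the Seidel matrix S only in columns i and j, by +2eⱼ and −2eᵢ.
-- Expanding det S′ multilinearly in these two columns, Cramer's rule evaluates the three new
-- determinants as det S · Bᵢⱼ, det S · Bⱼᵢ and det S · Bᵢⱼ · Bⱼᵢ (the last one because Bᵢᵢ = 0).
-- The inverse B of the skew-symmetric S is skew-symmetric, so the sum is det S · (1 + 2Bᵢⱼ)².
-- The inequalities then need det S > 0. It is nonzero since S is invertible (by induction: deleting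
-- a row and a column through a nonzero pivot of the inverse leaves a matrix inverted by a Schur
-- complement), and nonnegative since by the same Cramer computation, deleting rows and columns
-- 0 and k+1 from a skew-symmetric matrix multiplies its determinant by B₀,ₖ₊₁², so induction on
-- the size applies.
module Submission where

open import Defs
open import Level using (0ℓ)
open import Data.Nat using (ℕ; zero; suc) renaming (_+_ to _+ℕ_)
import Data.Nat.Properties as ℕ
open import Data.Fin using (Fin; zero; suc; punchIn; punchOut; toℕ; inject₁; _≟_)
open import Data.Fin.Properties using (punchIn-injective; punchInᵢ≢i; punchIn-punchOut; suc-injective; toℕ-injective; toℕ-inject₁)
open import Data.Bool using (Bool; true; false; not; if_then_else_)
open import Data.Rational using (ℚ; 0ℚ; 1ℚ; ½; -_; _+_; _*_; _-_; 1/_; _<_; _≤_; ≢-nonZero; positive; negative)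
open import Data.Rational.Properties using (+-*-commutativeRing; *-zeroˡ; *-zeroʳ;
  *-identityˡ; *-identityʳ; *-assoc; *-comm; neg-distrib-+; +-identityˡ; +-identityʳ)
import Data.Rational.Properties as ℚ
import Data.Fin.Properties as Fin
open import Relation.Binary.Definitions using (tri<; tri≈; tri>)
open import Data.Vec.Functional using (Vector)
open import Data.Product using (_×_; _,_; ∃-syntax; proj₁; proj₂)
open import Data.Sum using (_⊎_; inj₁; inj₂)
open import Function using (_∘_)
open import Relation.Binary.PropositionalEquality
open import Relation.Nullary using (Dec; yes; no; does; contradiction)
open import Relation.Nullary.Decidable using (dec⇒maybe)
open import Algebra.Bundles using (CommutativeRing)
open CommutativeRing +-*-commutativeRing using (semiring)
open import Algebra.Properties.Semiring.Sum semiring using (sum; sum-remove; ∑-distrib-+; ∑-comm; *-distribˡ-sum)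
open import Tactic.RingSolver.Core.AlmostCommutativeRing using (AlmostCommutativeRing; fromCommutativeRing)
open import Tactic.RingSolver using (solve-∀)
open ≡-Reasoning

private
  variable
    n m : ℕ

ℚ-ring : AlmostCommutativeRing 0ℓ 0ℓ
ℚ-ring = fromCommutativeRing +-*-commutativeRing (dec⇒maybe ∘ (0ℚ ℚ.≟_))

sumFin≡sum : (f : Vector ℚ n) → sumFin f ≡ sum f
sumFin≡sum {zero} f = refl
sumFin≡sum {suc n} f = cong (f zero +_) (sumFin≡sum (f ∘ suc))

sumFin-cong : {f g : Vector ℚ n} → (∀ k → f k ≡ g k) → sumFin f ≡ sumFin g
sumFin-cong {zero} f≗g = refl
sumFin-cong {suc n} f≗g = cong₂ _+_ (f≗g zero) (sumFin-cong (f≗g ∘ suc))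

sumFin-zero : {f : Vector ℚ n} → (∀ k → f k ≡ 0ℚ) → sumFin f ≡ 0ℚ
sumFin-zero {zero} f≗0 = refl
sumFin-zero {suc n} f≗0 = trans (cong₂ _+_ (f≗0 zero) (sumFin-zero (f≗0 ∘ suc))) (+-identityʳ 0ℚ)

sumFin-+ : (f g : Vector ℚ n) → sumFin (λ k → f k + g k) ≡ sumFin f + sumFin g
sumFin-+ f g = begin
  sumFin (λ k → f k + g k) ≡⟨ sumFin≡sum (λ k → f k + g k) ⟩
  sum (λ k → f k + g k)    ≡⟨ ∑-distrib-+ f g ⟩
  sum f + sum g            ≡⟨ cong₂ _+_ (sumFin≡sum f) (sumFin≡sum g) ⟨
  sumFin f + sumFin g      ∎

sumFin-*ˡ : (a : ℚ) (f : Vector ℚ n) → sumFin (λ k → a * f k) ≡ a * sumFin f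
sumFin-*ˡ a f = begin
  sumFin (λ k → a * f k) ≡⟨ sumFin≡sum (λ k → a * f k) ⟩
  sum (λ k → a * f k)    ≡⟨ *-distribˡ-sum a f ⟨
  a * sum f              ≡⟨ cong (a *_) (sumFin≡sum f) ⟨
  a * sumFin f           ∎

sumFin-*ʳ : (a : ℚ) (f : Vector ℚ n) → sumFin (λ k → f k * a) ≡ sumFin f * a
sumFin-*ʳ a f = trans (sumFin-cong (λ k → *-comm (f k) a)) (trans (sumFin-*ˡ a f) (*-comm a _))

sumFin-neg : (f : Vector ℚ n) → sumFin (λ k → - f k) ≡ - sumFin f
sumFin-neg {zero} f = refl
sumFin-neg {suc n} f = trans (cong (- f zero +_) (sumFin-neg (f ∘ suc))) (sym (neg-distrib-+ (f zero) (sumFin (f ∘ suc))))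

sumFin-- : (f g : Vector ℚ n) → sumFin (λ k → f k - g k) ≡ sumFin f - sumFin g
sumFin-- f g = trans (sumFin-+ f (λ k → - g k)) (cong (sumFin f +_) (sumFin-neg g))

sumFin-comm : (f : Fin n → Fin m → ℚ) →
  sumFin (λ k → sumFin (λ l → f k l)) ≡ sumFin (λ l → sumFin (λ k → f k l))
sumFin-comm f = begin
  sumFin (λ k → sumFin (f k))           ≡⟨ sumFin-cong (λ k → sumFin≡sum (f k)) ⟩
  sumFin (λ k → sum (f k))              ≡⟨ sumFin≡sum (λ k → sum (f k)) ⟩
  sum (λ k → sum (f k))                 ≡⟨ ∑-comm f ⟩
  sum (λ l → sum (λ k → f k l))         ≡⟨ sumFin≡sum (λ l → sum (λ k → f k l)) ⟨
  sumFin (λ l → sum (λ k → f k l))      ≡⟨ sumFin-cong (λ l → sumFin≡sum (λ k → f k l)) ⟨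
  sumFin (λ l → sumFin (λ k → f k l))   ∎

sumFin-punchIn : (p : Fin (suc n)) (f : Vector ℚ (suc n)) → sumFin f ≡ f p + sumFin (f ∘ punchIn p)
sumFin-punchIn p f = begin
  sumFin f                     ≡⟨ sumFin≡sum f ⟩
  sum f                        ≡⟨ sum-remove f ⟩
  f p + sum (f ∘ punchIn p)    ≡⟨ cong (f p +_) (sumFin≡sum (f ∘ punchIn p)) ⟨
  f p + sumFin (f ∘ punchIn p) ∎

sumFin-single : (p : Fin n) (f : Vector ℚ n) → (∀ k → k ≢ p → f k ≡ 0ℚ) → sumFin f ≡ f p
sumFin-single {suc n} p f f≡0 = begin
  sumFin f                     ≡⟨ sumFin-punchIn p f ⟩
  f p + sumFin (f ∘ punchIn p) ≡⟨ cong (f p +_) (sumFin-zero (λ k → f≡0 (punchIn p k) (punchInᵢ≢i p k))) ⟩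
  f p + 0ℚ                     ≡⟨ +-identityʳ (f p) ⟩
  f p                          ∎

sumFin-pair : (p q : Fin n) (f : Vector ℚ n) → p ≢ q → (∀ k → k ≢ p → k ≢ q → f k ≡ 0ℚ) →
  sumFin f ≡ f p + f q
sumFin-pair {suc n} p q f p≢q f≡0 = begin
  sumFin f                      ≡⟨ sumFin-punchIn p f ⟩
  f p + sumFin (f ∘ punchIn p)  ≡⟨ cong (f p +_) (sumFin-single q′ (f ∘ punchIn p) f′≡0) ⟩
  f p + f (punchIn p q′)        ≡⟨ cong (λ z → f p + f z) (punchIn-punchOut p≢q) ⟩
  f p + f q                     ∎
  where
  q′ : Fin n
  q′ = punchOut p≢q
  f′≡0 : ∀ k → k ≢ q′ → f (punchIn p k) ≡ 0ℚ
  f′≡0 k k≢q′ = f≡0 (punchIn p k) (punchInᵢ≢i p k)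
    (λ eq → k≢q′ (punchIn-injective p k q′ (trans eq (sym (punchIn-punchOut p≢q)))))

idMat-diag : (x : Fin n) → idMat x x ≡ 1ℚ
idMat-diag x with x ≟ x
... | yes _ = refl
... | no x≢x = contradiction refl x≢x

idMat-≢ : {x y : Fin n} → x ≢ y → idMat x y ≡ 0ℚ
idMat-≢ {x = x} {y} x≢y with x ≟ y
... | yes x≡y = contradiction x≡y x≢y
... | no _ = refl

idMat-sym : (x y : Fin n) → idMat x y ≡ idMat y x
idMat-sym x y with x ≟ y
... | yes refl = sym (idMat-diag x)
... | no x≢y = sym (idMat-≢ (x≢y ∘ sym))

idMat-punchIn : (r : Fin (suc n)) (x y : Fin n) → idMat (punchIn r x) (punchIn r y) ≡ idMat x y
idMat-punchIn r x y with x ≟ y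
... | yes refl = idMat-diag (punchIn r x)
... | no x≢y = idMat-≢ (x≢y ∘ punchIn-injective r x y)

sumFin-idMatʳ : (f : Vector ℚ n) (r : Fin n) → sumFin (λ k → f k * idMat k r) ≡ f r
sumFin-idMatʳ f r = begin
  sumFin (λ k → f k * idMat k r) ≡⟨ sumFin-single r _ (λ k k≢r → trans (cong (f k *_) (idMat-≢ k≢r)) (*-zeroʳ (f k))) ⟩
  f r * idMat r r                ≡⟨ cong (f r *_) (idMat-diag r) ⟩
  f r * 1ℚ                       ≡⟨ *-identityʳ (f r) ⟩
  f r                            ∎

sumFin-idMatˡ : (f : Vector ℚ n) (r : Fin n) → sumFin (λ k → idMat r k * f k) ≡ f r
sumFin-idMatˡ f r = trans (sumFin-cong (λ k → trans (*-comm (idMat r k) (f k)) (cong (f k *_) (idMat-sym r k))))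
  (sumFin-idMatʳ f r)

minor : Mat (suc n) → Fin (suc n) → Fin (suc n) → Mat n
minor M r c x y = M (punchIn r x) (punchIn c y)

laplaceTerm : Mat (suc n) → Fin (suc n) → ℚ
laplaceTerm M k = sgn (toℕ k) * (M zero k * det (minor M zero k))

laplaceTerm-minor≡0 : (M : Mat (suc n)) (k : Fin (suc n)) → det (minor M zero k) ≡ 0ℚ → laplaceTerm M k ≡ 0ℚ
laplaceTerm-minor≡0 M k minor≡0 = begin
  sgn (toℕ k) * (M zero k * det (minor M zero k)) ≡⟨ cong (λ d → sgn (toℕ k) * (M zero k * d)) minor≡0 ⟩
  sgn (toℕ k) * (M zero k * 0ℚ)                  ≡⟨ cong (sgn (toℕ k) *_) (*-zeroʳ (M zero k)) ⟩
  sgn (toℕ k) * 0ℚ                               ≡⟨ *-zeroʳ (sgn (toℕ k)) ⟩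
  0ℚ                                             ∎

det-cong : {M N : Mat n} → (∀ x y → M x y ≡ N x y) → det M ≡ det N
det-cong {zero} M≗N = refl
det-cong {suc n} M≗N = sumFin-cong λ k →
  cong₂ (λ a d → sgn (toℕ k) * (a * d)) (M≗N zero k) (det-cong (λ x y → M≗N (suc x) (punchIn k y)))

col : Mat n → Fin n → Vector ℚ n
col M c x = M x c

AgreeOffCol : Fin n → Mat n → Mat n → Set
AgreeOffCol c M N = ∀ x y → y ≢ c → M x y ≡ N x y

minor-agreeOffCol : {M N : Mat (suc n)} {k c : Fin (suc n)} (k≢c : k ≢ c) →
  AgreeOffCol c M N → AgreeOffCol (punchOut k≢c) (minor M zero k) (minor N zero k)
minor-agreeOffCol {k = k} {c} k≢c M~N x y y≢c′ = M~N (suc x) (punchIn k y) λ eq →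
  y≢c′ (punchIn-injective k y _ (trans eq (sym (punchIn-punchOut k≢c))))

agreeOffCol⇒minor≡ : {M N : Mat (suc n)} (c : Fin (suc n)) → AgreeOffCol c M N →
  ∀ x y → minor M zero c x y ≡ minor N zero c x y
agreeOffCol⇒minor≡ c M~N x y = M~N (suc x) (punchIn c y) (punchInᵢ≢i c y)

det-linear : (c : Fin n) (α β : ℚ) {P M N : Mat n} → AgreeOffCol c P M → AgreeOffCol c P N →
  (∀ x → P x c ≡ α * M x c + β * N x c) → det P ≡ α * det M + β * det N
det-linear {suc n} c α β {P} {M} {N} P~M P~N Pc = begin
  sumFin (laplaceTerm P)
    ≡⟨ sumFin-cong term-linear ⟩
  sumFin (λ k → α * laplaceTerm M k + β * laplaceTerm N k)
    ≡⟨ sumFin-+ (λ k → α * laplaceTerm M k) (λ k → β * laplaceTerm N k) ⟩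
  sumFin (λ k → α * laplaceTerm M k) + sumFin (λ k → β * laplaceTerm N k)
    ≡⟨ cong₂ _+_ (sumFin-*ˡ α (laplaceTerm M)) (sumFin-*ˡ β (laplaceTerm N)) ⟩
  α * det M + β * det N ∎
  where
  distrib-entry : ∀ s a b x y d → s * ((a * x + b * y) * d) ≡ a * (s * (x * d)) + b * (s * (y * d))
  distrib-entry = solve-∀ ℚ-ring
  distrib-minor : ∀ s a b p x y → s * (p * (a * x + b * y)) ≡ a * (s * (p * x)) + b * (s * (p * y))
  distrib-minor = solve-∀ ℚ-ring
  term-linear : ∀ k → laplaceTerm P k ≡ α * laplaceTerm M k + β * laplaceTerm N k
  term-linear k with k ≟ c
  ... | yes refl = begin
    sgn (toℕ k) * (P zero k * det (minor P zero k))
      ≡⟨ cong (λ a → sgn (toℕ k) * (a * det (minor P zero k))) (Pc zero) ⟩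
    sgn (toℕ k) * ((α * M zero k + β * N zero k) * det (minor P zero k))
      ≡⟨ distrib-entry (sgn (toℕ k)) α β (M zero k) (N zero k) (det (minor P zero k)) ⟩
    α * (sgn (toℕ k) * (M zero k * det (minor P zero k))) + β * (sgn (toℕ k) * (N zero k * det (minor P zero k)))
      ≡⟨ cong₂ (λ d d′ → α * (sgn (toℕ k) * (M zero k * d)) + β * (sgn (toℕ k) * (N zero k * d′)))
               (det-cong (agreeOffCol⇒minor≡ k P~M)) (det-cong (agreeOffCol⇒minor≡ k P~N)) ⟩
    α * laplaceTerm M k + β * laplaceTerm N k ∎
  ... | no k≢c = begin
    sgn (toℕ k) * (P zero k * det (minor P zero k))
      ≡⟨ cong (λ d → sgn (toℕ k) * (P zero k * d)) minor-linear ⟩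
    sgn (toℕ k) * (P zero k * (α * det (minor M zero k) + β * det (minor N zero k)))
      ≡⟨ distrib-minor (sgn (toℕ k)) α β (P zero k) (det (minor M zero k)) (det (minor N zero k)) ⟩
    α * (sgn (toℕ k) * (P zero k * det (minor M zero k))) + β * (sgn (toℕ k) * (P zero k * det (minor N zero k)))
      ≡⟨ cong₂ (λ a b → α * (sgn (toℕ k) * (a * det (minor M zero k))) + β * (sgn (toℕ k) * (b * det (minor N zero k))))
               (P~M zero k k≢c) (P~N zero k k≢c) ⟩
    α * laplaceTerm M k + β * laplaceTerm N k ∎
    where
    minor-linear : det (minor P zero k) ≡ α * det (minor M zero k) + β * det (minor N zero k)
    minor-linear = det-linear (punchOut k≢c) α β (minor-agreeOffCol k≢c P~M) (minor-agreeOffCol k≢c P~N)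
      (λ x → subst (λ z → P (suc x) z ≡ α * M (suc x) z + β * N (suc x) z)
                   (sym (punchIn-punchOut k≢c)) (Pc (suc x)))

det-zero-col : (c : Fin n) {M : Mat n} → (∀ x → M x c ≡ 0ℚ) → det M ≡ 0ℚ
det-zero-col c {M} Mc≡0 = begin
  det M                     ≡⟨ det-linear c 0ℚ 0ℚ (λ _ _ _ → refl) (λ _ _ _ → refl) column ⟩
  0ℚ * det M + 0ℚ * det M   ≡⟨ cong₂ _+_ (*-zeroˡ (det M)) (*-zeroˡ (det M)) ⟩
  0ℚ                        ∎
  where
  column : ∀ x → M x c ≡ 0ℚ * M x c + 0ℚ * M x c
  column x = trans (Mc≡0 x) (sym (cong₂ _+_ (*-zeroˡ (M x c)) (*-zeroˡ (M x c))))

setCol : Mat n → Fin n → Vector ℚ n → Mat n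
setCol M c v x y = if does (y ≟ c) then v x else M x y

setCol-col : (M : Mat n) (c : Fin n) (v : Vector ℚ n) (x : Fin n) → setCol M c v x c ≡ v x
setCol-col M c v x with c ≟ c
... | yes _ = refl
... | no c≢c = contradiction refl c≢c

setCol-agreeOffCol : (M : Mat n) (c : Fin n) (v : Vector ℚ n) → AgreeOffCol c (setCol M c v) M
setCol-agreeOffCol M c v x y y≢c with y ≟ c
... | yes y≡c = contradiction y≡c y≢c
... | no _ = refl

setCol-cong : (M : Mat n) (c : Fin n) {u v : Vector ℚ n} → (∀ x → u x ≡ v x) →
  ∀ x y → setCol M c u x y ≡ setCol M c v x y
setCol-cong M c u≗v x y with y ≟ c
... | yes _ = u≗v x
... | no _ = refl

setCol-self : (M : Mat n) (c : Fin n) (x y : Fin n) → setCol M c (col M c) x y ≡ M x y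
setCol-self M c x y with y ≟ c
... | yes refl = refl
... | no _ = refl

setCol-comm : (M : Mat n) {c d : Fin n} (u v : Vector ℚ n) → c ≢ d →
  ∀ x y → setCol (setCol M c u) d v x y ≡ setCol (setCol M d v) c u x y
setCol-comm M {c} {d} u v c≢d x y with y ≟ d | y ≟ c
... | yes refl | yes refl = contradiction refl c≢d
... | yes refl | no _ = refl
... | no _ | yes refl = refl
... | no _ | no _ = refl

det-setCol-linear : (M : Mat n) (c : Fin n) (α β : ℚ) {w u v : Vector ℚ n} →
  (∀ x → w x ≡ α * u x + β * v x) → det (setCol M c w) ≡ α * det (setCol M c u) + β * det (setCol M c v)
det-setCol-linear M c α β {w} {u} {v} w≡αu+βv = det-linear c α β (agree u) (agree v) λ x → begin
  setCol M c w x c                            ≡⟨ setCol-col M c w x ⟩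
  w x                                         ≡⟨ w≡αu+βv x ⟩
  α * u x + β * v x                           ≡⟨ cong₂ (λ a b → α * a + β * b) (setCol-col M c u x) (setCol-col M c v x) ⟨
  α * setCol M c u x c + β * setCol M c v x c ∎
  where
  agree : ∀ u → AgreeOffCol c (setCol M c w) (setCol M c u)
  agree u x y y≢c = trans (setCol-agreeOffCol M c w x y y≢c) (sym (setCol-agreeOffCol M c u x y y≢c))

det-setCol-+ : (M : Mat n) (c : Fin n) (u v : Vector ℚ n) →
  det (setCol M c (λ x → u x + v x)) ≡ det (setCol M c u) + det (setCol M c v)
det-setCol-+ M c u v = begin
  det (setCol M c (λ x → u x + v x))                ≡⟨ det-setCol-linear M c 1ℚ 1ℚ one* ⟩
  1ℚ * det (setCol M c u) + 1ℚ * det (setCol M c v)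
    ≡⟨ cong₂ _+_ (*-identityˡ (det (setCol M c u))) (*-identityˡ (det (setCol M c v))) ⟩
  det (setCol M c u) + det (setCol M c v)           ∎
  where
  one* : ∀ x → u x + v x ≡ 1ℚ * u x + 1ℚ * v x
  one* x = sym (cong₂ _+_ (*-identityˡ (u x)) (*-identityˡ (v x)))

det-add-col : (c : Fin n) (α : ℚ) (v : Vector ℚ n) {P M : Mat n} → AgreeOffCol c P M →
  (∀ x → P x c ≡ M x c + α * v x) → det P ≡ det M + α * det (setCol M c v)
det-add-col c α v {P} {M} P~M Pc = begin
  det P                                       ≡⟨ det-linear c 1ℚ α P~M P~Mv column ⟩
  1ℚ * det M + α * det (setCol M c v)         ≡⟨ cong (_+ α * det (setCol M c v)) (*-identityˡ (det M)) ⟩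
  det M + α * det (setCol M c v)              ∎
  where
  P~Mv : AgreeOffCol c P (setCol M c v)
  P~Mv x y y≢c = trans (P~M x y y≢c) (sym (setCol-agreeOffCol M c v x y y≢c))
  column : ∀ x → P x c ≡ 1ℚ * M x c + α * setCol M c v x c
  column x = trans (Pc x) (cong₂ _+_ (sym (*-identityˡ (M x c))) (cong (α *_) (sym (setCol-col M c v x))))

agreeOffCol-setCol : {c d : Fin n} {P M : Mat n} (v : Vector ℚ n) → AgreeOffCol c P M →
  AgreeOffCol c (setCol P d v) (setCol M d v)
agreeOffCol-setCol {d = d} v P~M x y y≢c with y ≟ d
... | yes _ = refl
... | no _ = P~M x y y≢c

data Adjacent : Fin n → Fin n → Set where
  first : Adjacent {suc (suc n)} zero (suc zero)
  next  : {c d : Fin n} → Adjacent c d → Adjacent (suc c) (suc d)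

adjacent-≢ : {c d : Fin n} → Adjacent c d → c ≢ d
adjacent-≢ first ()
adjacent-≢ (next a) eq = adjacent-≢ a (suc-injective eq)

adjacent-sgn : {c d : Fin n} → Adjacent c d → sgn (toℕ d) ≡ - sgn (toℕ c)
adjacent-sgn first = refl
adjacent-sgn (next a) = cong -_ (adjacent-sgn a)

adjacent-inject₁ : (d : Fin (suc n)) → Adjacent (inject₁ d) (suc d)
adjacent-inject₁ zero = first
adjacent-inject₁ {suc n} (suc d) = next (adjacent-inject₁ d)

adjacent-punchIn : {c d : Fin (suc n)} → Adjacent c d → (y : Fin n) →
  punchIn c y ≡ punchIn d y ⊎ (punchIn c y ≡ d × punchIn d y ≡ c)
adjacent-punchIn first zero = inj₂ (refl , refl)
adjacent-punchIn first (suc y) = inj₁ refl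
adjacent-punchIn (next a) zero = inj₁ refl
adjacent-punchIn (next a) (suc y) with adjacent-punchIn a y
... | inj₁ eq = inj₁ (cong suc eq)
... | inj₂ (eq₁ , eq₂) = inj₂ (cong suc eq₁ , cong suc eq₂)

adjacent-punchIn⁻¹ : {c d : Fin (suc n)} → Adjacent c d → (k : Fin (suc n)) → k ≢ c → k ≢ d →
  ∃[ c′ ] ∃[ d′ ] Adjacent c′ d′ × punchIn k c′ ≡ c × punchIn k d′ ≡ d
adjacent-punchIn⁻¹ first zero k≢c k≢d = contradiction refl k≢c
adjacent-punchIn⁻¹ first (suc zero) k≢c k≢d = contradiction refl k≢d
adjacent-punchIn⁻¹ {suc (suc n)} first (suc (suc k)) k≢c k≢d = zero , suc zero , first , refl , refl
adjacent-punchIn⁻¹ (next {c = c} {d} a) zero k≢c k≢d = c , d , a , refl , refl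
adjacent-punchIn⁻¹ {suc n} (next a) (suc k) k≢c k≢d with adjacent-punchIn⁻¹ a k (k≢c ∘ cong suc) (k≢d ∘ cong suc)
... | c′ , d′ , a′ , eq₁ , eq₂ = suc c′ , suc d′ , next a′ , cong suc eq₁ , cong suc eq₂

det-adjacent-equal : {c d : Fin n} → Adjacent c d → {M : Mat n} → (∀ x → M x c ≡ M x d) → det M ≡ 0ℚ
det-adjacent-equal {zero} {()}
det-adjacent-equal {suc n} {c} {d} a {M} Mc≡Md =
  trans (sumFin-pair c d (laplaceTerm M) (adjacent-≢ a) other-terms) pair-cancels
  where
  other-terms : ∀ k → k ≢ c → k ≢ d → laplaceTerm M k ≡ 0ℚ
  other-terms k k≢c k≢d with adjacent-punchIn⁻¹ a k k≢c k≢d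
  ... | c′ , d′ , a′ , eq₁ , eq₂ = laplaceTerm-minor≡0 M k (det-adjacent-equal a′ minor-equal)
    where
    minor-equal : ∀ x → minor M zero k x c′ ≡ minor M zero k x d′
    minor-equal x = subst₂ (λ u v → M (suc x) u ≡ M (suc x) v) (sym eq₁) (sym eq₂) (Mc≡Md (suc x))
  minor-c≡minor-d : ∀ x y → minor M zero c x y ≡ minor M zero d x y
  minor-c≡minor-d x y with adjacent-punchIn a y
  ... | inj₁ eq = cong (M (suc x)) eq
  ... | inj₂ (eq₁ , eq₂) = trans (cong (M (suc x)) eq₁) (trans (sym (Mc≡Md (suc x))) (cong (M (suc x)) (sym eq₂)))
  cancel : ∀ s t → s * t + (- s) * t ≡ 0ℚ
  cancel = solve-∀ ℚ-ring
  pair-cancels : laplaceTerm M c + laplaceTerm M d ≡ 0ℚ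
  pair-cancels = begin
    sgn (toℕ c) * (M zero c * det (minor M zero c)) + sgn (toℕ d) * (M zero d * det (minor M zero d))
      ≡⟨ cong₂ (λ s e → sgn (toℕ c) * (M zero c * det (minor M zero c)) + s * (e * det (minor M zero d)))
               (adjacent-sgn a) (sym (Mc≡Md zero)) ⟩
    sgn (toℕ c) * (M zero c * det (minor M zero c)) + (- sgn (toℕ c)) * (M zero c * det (minor M zero d))
      ≡⟨ cong (λ m → sgn (toℕ c) * (M zero c * det (minor M zero c)) + (- sgn (toℕ c)) * (M zero c * m))
              (det-cong (λ x y → sym (minor-c≡minor-d x y))) ⟩
    sgn (toℕ c) * (M zero c * det (minor M zero c)) + (- sgn (toℕ c)) * (M zero c * det (minor M zero c))
      ≡⟨ cancel (sgn (toℕ c)) (M zero c * det (minor M zero c)) ⟩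
    0ℚ ∎

swapCols : Mat n → Fin n → Fin n → Mat n
swapCols M c d = setCol (setCol M c (col M d)) d (col M c)

-- With Z p q the matrix having columns p, q at c, d: expanding 0 = det (Z (u + v) (u + v)) bilinearly
-- leaves det M + det (swapCols M c d), the other two terms having equal adjacent columns.
det-swapCols-adjacent : {c d : Fin n} → Adjacent c d → (M : Mat n) → det (swapCols M c d) ≡ - det M
det-swapCols-adjacent {n} {c} {d} a M = +-inverseʳ-unique (det M) (det (swapCols M c d)) (sym (begin
  0ℚ
    ≡⟨ Z-equal w ⟨
  det (Z w w)
    ≡⟨ Z-split w ⟩
  det (Z u w) + det (Z v w)
    ≡⟨ cong₂ _+_ (det-setCol-+ (setCol M c u) d u v) (det-setCol-+ (setCol M c v) d u v) ⟩
  (det (Z u u) + det (Z u v)) + (det (Z v u) + det (Z v v))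
    ≡⟨ cong₂ (λ s t → (s + det (Z u v)) + (det (Z v u) + t)) (Z-equal u) (Z-equal v) ⟩
  (0ℚ + det (Z u v)) + (det (Z v u) + 0ℚ)
    ≡⟨ cong₂ _+_ (+-identityˡ (det (Z u v))) (+-identityʳ (det (Z v u))) ⟩
  det (Z u v) + det (Z v u)
    ≡⟨ cong (_+ det (Z v u)) (det-cong Z-cols) ⟩
  det M + det (swapCols M c d) ∎))
  where
  open import Algebra.Properties.Group ℚ.+-0-group using () renaming (inverseʳ-unique to +-inverseʳ-unique)
  c≢d : c ≢ d
  c≢d = adjacent-≢ a
  u v w : Vector ℚ n
  u = col M c
  v = col M d
  w x = u x + v x
  Z : Vector ℚ n → Vector ℚ n → Mat n
  Z p q = setCol (setCol M c p) d q
  Z-equal : ∀ p → det (Z p p) ≡ 0ℚ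
  Z-equal p = det-adjacent-equal a λ x →
    trans (setCol-agreeOffCol (setCol M c p) d p x c c≢d) (trans (setCol-col M c p x) (sym (setCol-col (setCol M c p) d p x)))
  Z-split : ∀ q → det (Z w q) ≡ det (Z u q) + det (Z v q)
  Z-split q = begin
    det (Z w q)                                               ≡⟨ det-cong (setCol-comm M w q c≢d) ⟩
    det (setCol (setCol M d q) c w)                           ≡⟨ det-setCol-+ (setCol M d q) c u v ⟩
    det (setCol (setCol M d q) c u) + det (setCol (setCol M d q) c v)
      ≡⟨ cong₂ _+_ (det-cong (λ x y → sym (setCol-comm M u q c≢d x y)))
                   (det-cong (λ x y → sym (setCol-comm M v q c≢d x y))) ⟩
    det (Z u q) + det (Z v q)                                 ∎
  Z-cols : ∀ x y → Z u v x y ≡ M x y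
  Z-cols x y with y ≟ d | y ≟ c
  ... | yes refl | _ = refl
  ... | no _ | yes refl = refl
  ... | no _ | no _ = refl

-- Swapping d with its left neighbour negates det and shrinks the gap between the equal columns.
det-equal-cols-gap : (g : ℕ) {c d : Fin n} → suc (toℕ c +ℕ g) ≡ toℕ d →
  {M : Mat n} → (∀ x → M x c ≡ M x d) → det M ≡ 0ℚ
det-equal-cols-gap {suc (suc n)} zero {c} {suc d} gap {M} Mc≡Md =
  det-adjacent-equal (subst (λ f → Adjacent f (suc d)) f≡c (adjacent-inject₁ d)) {M} Mc≡Md
  where
  f≡c : inject₁ d ≡ c
  f≡c = toℕ-injective (trans (toℕ-inject₁ d) (sym (trans (sym (ℕ.+-identityʳ (toℕ c))) (ℕ.suc-injective gap))))
det-equal-cols-gap {suc (suc n)} (suc g) {c} {suc d} gap {M} Mc≡Md = ℚ.neg-injective (begin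
  - det M                ≡⟨ det-swapCols-adjacent (adjacent-inject₁ d) M ⟨
  det (swapCols M f d′)  ≡⟨ det-equal-cols-gap g gap′ {swapCols M f d′} N-equal ⟩
  0ℚ                     ∎)
  where
  f d′ : Fin (suc (suc n))
  f = inject₁ d
  d′ = suc d
  gap′ : suc (toℕ c +ℕ g) ≡ toℕ f
  gap′ = trans (sym (ℕ.+-suc (toℕ c) g)) (trans (ℕ.suc-injective gap) (sym (toℕ-inject₁ d)))
  c≢f : c ≢ f
  c≢f c≡f = ℕ.m≢1+m+n (toℕ c) (trans (cong toℕ c≡f) (sym gap′))
  c≢d′ : c ≢ d′
  c≢d′ c≡d′ = ℕ.m≢1+m+n (toℕ c) (trans (cong toℕ c≡d′) (sym gap))
  f≢d′ : f ≢ d′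
  f≢d′ = adjacent-≢ (adjacent-inject₁ d)
  N-equal : ∀ x → swapCols M f d′ x c ≡ swapCols M f d′ x f
  N-equal x = begin
    swapCols M f d′ x c          ≡⟨ setCol-agreeOffCol (setCol M f (col M d′)) d′ (col M f) x c c≢d′ ⟩
    setCol M f (col M d′) x c    ≡⟨ setCol-agreeOffCol M f (col M d′) x c c≢f ⟩
    M x c                        ≡⟨ Mc≡Md x ⟩
    M x d′                       ≡⟨ setCol-col M f (col M d′) x ⟨
    setCol M f (col M d′) x f    ≡⟨ setCol-agreeOffCol (setCol M f (col M d′)) d′ (col M f) x f f≢d′ ⟨
    swapCols M f d′ x f          ∎

det-equal-cols : {c d : Fin n} → c ≢ d → {M : Mat n} → (∀ x → M x c ≡ M x d) → det M ≡ 0ℚ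
det-equal-cols {c = c} {d} c≢d Mc≡Md with Fin.<-cmp c d
... | tri< c<d _ _ = det-equal-cols-gap _ (proj₂ (ℕ.m≤n⇒∃[o]m+o≡n c<d)) Mc≡Md
... | tri≈ _ c≡d _ = contradiction c≡d c≢d
... | tri> _ _ d<c = det-equal-cols-gap _ (proj₂ (ℕ.m≤n⇒∃[o]m+o≡n d<c)) (sym ∘ Mc≡Md)

basis : Fin n → Vector ℚ n
basis r x = idMat x r

adj : Mat n → Mat n
adj M c r = det (setCol M c (basis r))

det-setCol-sum : (M : Mat n) (c : Fin n) (f : Vector ℚ m) (v : Fin m → Vector ℚ n) →
  det (setCol M c (λ x → sumFin (λ r → f r * v r x))) ≡ sumFin (λ r → f r * det (setCol M c (v r)))
det-setCol-sum {m = zero} M c f v = det-zero-col c (setCol-col M c (λ _ → 0ℚ))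
det-setCol-sum {n} {suc m} M c f v = begin
  det (setCol M c (λ x → sumFin (λ r → f r * v r x)))
    ≡⟨ det-setCol-linear M c (f zero) 1ℚ (λ x → cong (f zero * v zero x +_) (sym (*-identityˡ (rest x)))) ⟩
  f zero * det (setCol M c (v zero)) + 1ℚ * det (setCol M c rest)
    ≡⟨ cong (f zero * det (setCol M c (v zero)) +_) (*-identityˡ (det (setCol M c rest))) ⟩
  f zero * det (setCol M c (v zero)) + det (setCol M c rest)
    ≡⟨ cong (f zero * det (setCol M c (v zero)) +_) (det-setCol-sum M c (f ∘ suc) (v ∘ suc)) ⟩
  sumFin (λ r → f r * det (setCol M c (v r))) ∎
  where
  rest : Vector ℚ n
  rest x = sumFin (λ r → f (suc r) * v (suc r) x)

adj-⊗ : (M : Mat n) (c c′ : Fin n) → (adj M ⊗ M) c c′ ≡ det M * idMat c c′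
adj-⊗ M c c′ = begin
  sumFin (λ r → adj M c r * M r c′)                       ≡⟨ sumFin-cong (λ r → *-comm (adj M c r) (M r c′)) ⟩
  sumFin (λ r → M r c′ * det (setCol M c (basis r)))      ≡⟨ det-setCol-sum M c (col M c′) basis ⟨
  det (setCol M c (λ x → sumFin (λ r → M r c′ * idMat x r)))
    ≡⟨ det-cong (setCol-cong M c λ x →
         trans (sumFin-cong (λ r → cong (M r c′ *_) (idMat-sym x r))) (sumFin-idMatʳ (col M c′) x)) ⟩
  det (setCol M c (col M c′))                             ≡⟨ cols c c′ ⟩
  det M * idMat c c′                                      ∎
  where
  cols : ∀ c c′ → det (setCol M c (col M c′)) ≡ det M * idMat c c′
  cols c c′ with c ≟ c′
  ... | yes refl = trans (det-cong (setCol-self M c)) (sym (*-identityʳ (det M)))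
  ... | no c≢c′ = trans (det-equal-cols c≢c′ equal-cols) (sym (*-zeroʳ (det M)))
    where
    equal-cols : ∀ x → setCol M c (col M c′) x c ≡ setCol M c (col M c′) x c′
    equal-cols x = trans (setCol-col M c (col M c′) x) (sym (setCol-agreeOffCol M c (col M c′) x c′ (c≢c′ ∘ sym)))

⊗-assoc : (X Y Z : Mat n) (x y : Fin n) → ((X ⊗ Y) ⊗ Z) x y ≡ (X ⊗ (Y ⊗ Z)) x y
⊗-assoc X Y Z x y = begin
  sumFin (λ k → sumFin (λ l → X x l * Y l k) * Z k y)
    ≡⟨ sumFin-cong (λ k → sumFin-*ʳ (Z k y) (λ l → X x l * Y l k)) ⟨
  sumFin (λ k → sumFin (λ l → X x l * Y l k * Z k y))
    ≡⟨ sumFin-comm (λ k l → X x l * Y l k * Z k y) ⟩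
  sumFin (λ l → sumFin (λ k → X x l * Y l k * Z k y))
    ≡⟨ sumFin-cong (λ l → sumFin-cong (λ k → *-assoc (X x l) (Y l k) (Z k y))) ⟩
  sumFin (λ l → sumFin (λ k → X x l * (Y l k * Z k y)))
    ≡⟨ sumFin-cong (λ l → sumFin-*ˡ (X x l) (λ k → Y l k * Z k y)) ⟩
  sumFin (λ l → X x l * sumFin (λ k → Y l k * Z k y)) ∎

cramer : (M B : Mat n) {r : Fin n} → (∀ x → (M ⊗ B) x r ≡ idMat x r) → ∀ c → adj M c r ≡ det M * B c r
cramer M B {r} MB≡I c = begin
  adj M c r                                  ≡⟨ sumFin-idMatʳ (adj M c) r ⟨
  sumFin (λ t → adj M c t * idMat t r)       ≡⟨ sumFin-cong (λ t → cong (adj M c t *_) (MB≡I t)) ⟨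
  (adj M ⊗ (M ⊗ B)) c r                      ≡⟨ ⊗-assoc (adj M) M B c r ⟨
  ((adj M ⊗ M) ⊗ B) c r                      ≡⟨ sumFin-cong (λ u → cong (_* B u r) (adj-⊗ M c u)) ⟩
  sumFin (λ u → det M * idMat c u * B u r)   ≡⟨ sumFin-cong (λ u → *-assoc (det M) (idMat c u) (B u r)) ⟩
  sumFin (λ u → det M * (idMat c u * B u r)) ≡⟨ sumFin-*ˡ (det M) (λ u → idMat c u * B u r) ⟩
  det M * sumFin (λ u → idMat c u * B u r)   ≡⟨ cong (det M *_) (sumFin-idMatˡ (col B r) c) ⟩
  det M * B c r                              ∎

sgn-sgn : (k : ℕ) (a : ℚ) → sgn k * (sgn k * a) ≡ a
sgn-sgn zero a = trans (*-identityˡ (1ℚ * a)) (*-identityˡ a)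
sgn-sgn (suc k) a = trans (neg-twice (sgn k) a) (sgn-sgn k a)
  where
  neg-twice : ∀ s a → (- s) * ((- s) * a) ≡ s * (s * a)
  neg-twice = solve-∀ ℚ-ring

sgn-cancel : (k : ℕ) {a : ℚ} → sgn k * a ≡ 0ℚ → a ≡ 0ℚ
sgn-cancel k {a} sa≡0 = trans (sym (sgn-sgn k a)) (trans (cong (sgn k *_) sa≡0) (*-zeroʳ (sgn k)))

det-col≡basis₀ : (M : Mat (suc n)) (c : Fin (suc n)) → (∀ x → M x c ≡ basis zero x) →
  det M ≡ sgn (toℕ c) * det (minor M zero c)
det-col≡basis₀ M c Mc≡e₀ = begin
  sumFin (laplaceTerm M)                            ≡⟨ sumFin-single c (laplaceTerm M) other-terms ⟩
  sgn (toℕ c) * (M zero c * det (minor M zero c))   ≡⟨ cong (λ a → sgn (toℕ c) * (a * det (minor M zero c))) (Mc≡e₀ zero) ⟩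
  sgn (toℕ c) * (1ℚ * det (minor M zero c))         ≡⟨ cong (sgn (toℕ c) *_) (*-identityˡ (det (minor M zero c))) ⟩
  sgn (toℕ c) * det (minor M zero c)                ∎
  where
  other-terms : ∀ k → k ≢ c → laplaceTerm M k ≡ 0ℚ
  other-terms k k≢c = laplaceTerm-minor≡0 M k (det-zero-col (punchOut k≢c) λ x →
    trans (cong (M (suc x)) (punchIn-punchOut k≢c)) (Mc≡e₀ (suc x)))

det-col₀≡basis : (M : Mat (suc n)) (r : Fin (suc n)) → (∀ x → M x zero ≡ basis r x) →
  det M ≡ sgn (toℕ r) * det (minor M r zero)
det-col₀≡basis M zero M₀≡e = det-col≡basis₀ M zero M₀≡e
det-col₀≡basis {suc n} M (suc s) M₀≡e = begin
  laplaceTerm M zero + sumFin (laplaceTerm M ∘ suc)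
    ≡⟨ cong₂ _+_ first-term (sumFin-cong later-term) ⟩
  0ℚ + sumFin (λ k → - sgn (toℕ s) * (sgn (toℕ k) * (M zero (suc k) * D k)))
    ≡⟨ +-identityˡ _ ⟩
  sumFin (λ k → - sgn (toℕ s) * (sgn (toℕ k) * (M zero (suc k) * D k)))
    ≡⟨ sumFin-*ˡ (- sgn (toℕ s)) (λ k → sgn (toℕ k) * (M zero (suc k) * D k)) ⟩
  - sgn (toℕ s) * sumFin (λ k → sgn (toℕ k) * (M zero (suc k) * D k)) ∎
  where
  D : Fin (suc n) → ℚ
  D k = det (minor (minor M zero (suc k)) s zero)
  first-term : laplaceTerm M zero ≡ 0ℚ
  first-term = trans (cong (λ a → sgn 0 * (a * det (minor M zero zero))) (M₀≡e zero))
    (trans (cong (sgn 0 *_) (*-zeroˡ (det (minor M zero zero)))) (*-zeroʳ (sgn 0)))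
  reorder : ∀ a b m d → (- a) * (m * (b * d)) ≡ (- b) * (a * (m * d))
  reorder = solve-∀ ℚ-ring
  later-term : ∀ k → laplaceTerm M (suc k) ≡ - sgn (toℕ s) * (sgn (toℕ k) * (M zero (suc k) * D k))
  later-term k = begin
    - sgn (toℕ k) * (M zero (suc k) * det (minor M zero (suc k)))
      ≡⟨ cong (λ d → - sgn (toℕ k) * (M zero (suc k) * d)) (det-col₀≡basis (minor M zero (suc k)) s (M₀≡e ∘ suc)) ⟩
    - sgn (toℕ k) * (M zero (suc k) * (sgn (toℕ s) * D k))
      ≡⟨ reorder (sgn (toℕ k)) (sgn (toℕ s)) (M zero (suc k)) (D k) ⟩
    - sgn (toℕ s) * (sgn (toℕ k) * (M zero (suc k) * D k)) ∎

-- Column i of S ⊗ B is unchanged when column i of S is replaced by eⱼ, because Bᵢᵢ = 0;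
-- so Cramer's rule applies twice.
det-setCol-basis-pair : (S B : Mat n) → (∀ x y → (S ⊗ B) x y ≡ idMat x y) → {i : Fin n} → B i i ≡ 0ℚ →
  (j : Fin n) → det (setCol (setCol S i (basis j)) j (basis i)) ≡ det S * B i j * B j i
det-setCol-basis-pair {n} S B SB≡I {i} Bii≡0 j = begin
  adj N j i      ≡⟨ cramer N B NB≡I j ⟩
  det N * B j i  ≡⟨ cong (_* B j i) (cramer S B (λ x → SB≡I x j) i) ⟩
  det S * B i j * B j i ∎
  where
  N : Mat n
  N = setCol S i (basis j)
  entry : ∀ x u → N x u * B u i ≡ S x u * B u i
  entry x u with u ≟ i
  ... | yes refl = begin
    basis j x * B i i ≡⟨ cong (basis j x *_) Bii≡0 ⟩
    basis j x * 0ℚ    ≡⟨ *-zeroʳ (basis j x) ⟩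
    0ℚ                ≡⟨ *-zeroʳ (S x i) ⟨
    S x i * 0ℚ        ≡⟨ cong (S x i *_) Bii≡0 ⟨
    S x i * B i i     ∎
  ... | no _ = refl
  NB≡I : ∀ x → (N ⊗ B) x i ≡ idMat x i
  NB≡I x = trans (sumFin-cong (entry x)) (SB≡I x i)

det-setCol-basis-swap : (M : Mat (suc (suc n))) (k : Fin (suc n)) →
  det (setCol (setCol M zero (basis (suc k))) (suc k) (basis zero)) ≡ - det (minor (minor M zero zero) k k)
det-setCol-basis-swap {n} M k = begin
  det X
    ≡⟨ det-col≡basis₀ X (suc k) (setCol-col X₁ (suc k) (basis zero)) ⟩
  sgn (toℕ (suc k)) * det (minor X zero (suc k))
    ≡⟨ cong (sgn (toℕ (suc k)) *_) (det-col₀≡basis (minor X zero (suc k)) k col₀) ⟩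
  - sgn (toℕ k) * (sgn (toℕ k) * det (minor (minor X zero (suc k)) k zero))
    ≡⟨ cong (λ d → - sgn (toℕ k) * (sgn (toℕ k) * d)) (det-cong principal) ⟩
  - sgn (toℕ k) * (sgn (toℕ k) * P)
    ≡⟨ ℚ.neg-distribˡ-* (sgn (toℕ k)) (sgn (toℕ k) * P) ⟨
  - (sgn (toℕ k) * (sgn (toℕ k) * P))
    ≡⟨ cong -_ (sgn-sgn (toℕ k) P) ⟩
  - P ∎
  where
  X₁ X : Mat (suc (suc n))
  X₁ = setCol M zero (basis (suc k))
  X = setCol X₁ (suc k) (basis zero)
  P : ℚ
  P = det (minor (minor M zero zero) k k)
  col₀ : ∀ x → minor X zero (suc k) x zero ≡ basis k x
  col₀ x = trans (setCol-agreeOffCol X₁ (suc k) (basis zero) (suc x) zero (λ ())) (setCol-col M zero (basis (suc k)) (suc x))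
  principal : ∀ x y → minor (minor X zero (suc k)) k zero x y ≡ minor (minor M zero zero) k k x y
  principal x y = trans (setCol-agreeOffCol X₁ (suc k) (basis zero) _ _ (punchInᵢ≢i k y ∘ suc-injective))
    (setCol-agreeOffCol M zero (basis (suc k)) _ _ (λ ()))

Skew : Mat n → Set
Skew {n} M = (x y : Fin n) → M x y ≡ - M y x

skew-diag : {M : Mat n} → Skew M → ∀ x → M x x ≡ 0ℚ
skew-diag {M = M} skew x = begin
  M x x               ≡⟨ halve (M x x) ⟩
  ½ * (M x x + M x x) ≡⟨ cong (λ a → ½ * (M x x + a)) (skew x x) ⟩
  ½ * (M x x - M x x) ≡⟨ cong (½ *_) (ℚ.+-inverseʳ (M x x)) ⟩
  ½ * 0ℚ              ≡⟨ *-zeroʳ ½ ⟩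
  0ℚ                  ∎
  where
  halve : ∀ a → a ≡ ½ * (a + a)
  halve = solve-∀ ℚ-ring

skew-inverse : (S B : Mat n) → Skew S → (∀ x y → (B ⊗ S) x y ≡ idMat x y) →
  Skew B × (∀ x y → (S ⊗ B) x y ≡ idMat x y)
skew-inverse {n} S B skew BS≡I = skewB , SB≡I
  where
  -- C = −Bᵀ is a right inverse of S, hence B = B (S C) = (B S) C = C.
  C : Mat n
  C x y = - B y x
  neg-swap : ∀ s b → (- s) * (- b) ≡ b * s
  neg-swap = solve-∀ ℚ-ring
  SC≡I : ∀ x y → (S ⊗ C) x y ≡ idMat x y
  SC≡I x y = begin
    sumFin (λ u → S x u * - B y u) ≡⟨ sumFin-cong (λ u → trans (cong (_* - B y u) (skew x u)) (neg-swap (S u x) (B y u))) ⟩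
    sumFin (λ u → B y u * S u x)   ≡⟨ BS≡I y x ⟩
    idMat y x                      ≡⟨ idMat-sym y x ⟩
    idMat x y                      ∎
  skewB : Skew B
  skewB x y = sym (begin
    - B y x                        ≡⟨ sumFin-idMatˡ (col C y) x ⟨
    sumFin (λ t → idMat x t * C t y) ≡⟨ sumFin-cong (λ t → cong (_* C t y) (BS≡I x t)) ⟨
    ((B ⊗ S) ⊗ C) x y              ≡⟨ ⊗-assoc B S C x y ⟩
    sumFin (λ t → B x t * (S ⊗ C) t y) ≡⟨ sumFin-cong (λ t → cong (B x t *_) (SC≡I t y)) ⟩
    sumFin (λ t → B x t * idMat t y) ≡⟨ sumFin-idMatʳ (B x) y ⟩
    B x y                          ∎)
  SB≡I : ∀ x y → (S ⊗ B) x y ≡ idMat x y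
  SB≡I x y = trans (sumFin-cong (λ u → cong (S x u *_) (skewB u y))) (SC≡I x y)

det-principal-minor₂ : (S B : Mat (suc (suc n))) → Skew B → (∀ x y → (S ⊗ B) x y ≡ idMat x y) →
  (k : Fin (suc n)) → det (minor (minor S zero zero) k k) ≡ det S * (B zero (suc k) * B zero (suc k))
det-principal-minor₂ S B skewB SB≡I k = ℚ.neg-injective (begin
  - det (minor (minor S zero zero) k k)
    ≡⟨ det-setCol-basis-swap S k ⟨
  det (setCol (setCol S zero (basis (suc k))) (suc k) (basis zero))
    ≡⟨ det-setCol-basis-pair S B SB≡I (skew-diag skewB zero) (suc k) ⟩
  det S * b * B (suc k) zero
    ≡⟨ cong (det S * b *_) (skewB (suc k) zero) ⟩
  det S * b * - b
    ≡⟨ rearrange (det S) b ⟩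
  - (det S * (b * b)) ∎)
  where
  b : ℚ
  b = B zero (suc k)
  rearrange : ∀ d b → d * b * - b ≡ - (d * (b * b))
  rearrange = solve-∀ ℚ-ring

inverse-row-nonzero : (B M : Mat n) → (∀ x y → (B ⊗ M) x y ≡ idMat x y) → ∀ x → ∃[ k ] B x k ≢ 0ℚ
inverse-row-nonzero {n} B M BM≡I x = Fin.¬∀⟶∃¬ n (λ k → B x k ≡ 0ℚ) (λ k → B x k ℚ.≟ 0ℚ) λ row≡0 →
  1≢0 (begin
    1ℚ           ≡⟨ idMat-diag x ⟨
    idMat x x    ≡⟨ BM≡I x x ⟨
    (B ⊗ M) x x  ≡⟨ sumFin-zero (λ k → trans (cong (_* M k x) (row≡0 k)) (*-zeroˡ (M k x))) ⟩
    0ℚ           ∎)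
  where
  1≢0 : 1ℚ ≢ 0ℚ
  1≢0 ()

pivot-cancel : {a p β γ T₁ T₂ δ : ℚ} → a * p + T₁ ≡ δ → β * p + T₂ ≡ 0ℚ → β * γ ≡ 1ℚ →
  T₁ - a * γ * T₂ ≡ δ
pivot-cancel {a} {p} {β} {γ} {T₁} {T₂} {δ} h₁ h₂ h₃ = begin
  T₁ - a * γ * T₂
    ≡⟨ expand a p β γ T₁ T₂ ⟩
  (a * p + T₁) - a * γ * (β * p + T₂) + a * p * (β * γ - 1ℚ)
    ≡⟨ cong (λ t → t - a * γ * (β * p + T₂) + a * p * (β * γ - 1ℚ)) h₁ ⟩
  δ - a * γ * (β * p + T₂) + a * p * (β * γ - 1ℚ)
    ≡⟨ cong (λ t → δ - a * γ * t + a * p * (β * γ - 1ℚ)) h₂ ⟩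
  δ - a * γ * 0ℚ + a * p * (β * γ - 1ℚ)
    ≡⟨ cong (λ t → δ - a * γ * 0ℚ + a * p * (t - 1ℚ)) h₃ ⟩
  δ - a * γ * 0ℚ + a * p * (1ℚ - 1ℚ)
    ≡⟨ collapse δ a p γ ⟩
  δ ∎
  where
  expand : ∀ a p β γ T₁ T₂ → T₁ - a * γ * T₂ ≡ (a * p + T₁) - a * γ * (β * p + T₂) + a * p * (β * γ - 1ℚ)
  expand = solve-∀ ℚ-ring
  collapse : ∀ δ a p γ → δ - a * γ * 0ℚ + a * p * (1ℚ - 1ℚ) ≡ δ
  collapse = solve-∀ ℚ-ring

module _ (M B : Mat (suc n)) (MB≡I : ∀ x y → (M ⊗ B) x y ≡ idMat x y) (BM≡I : ∀ x y → (B ⊗ M) x y ≡ idMat x y)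
         {r : Fin (suc n)} (β≢0 : B zero r ≢ 0ℚ) where

  private
    β γ : ℚ
    β = B zero r
    γ = 1/_ β {{≢-nonZero β≢0}}
    βγ≡1 : β * γ ≡ 1ℚ
    βγ≡1 = ℚ.*-inverseʳ β {{≢-nonZero β≢0}}

  schurComplement : Mat n
  schurComplement y z = B (suc y) (punchIn r z) - B (suc y) r * γ * B zero (punchIn r z)

  minor-⊗-schurComplement : ∀ x z → (minor M r zero ⊗ schurComplement) x z ≡ idMat x z
  minor-⊗-schurComplement x z = begin
    sumFin (λ y → u y * schurComplement y z)
      ≡⟨ sumFin-cong (λ y → distrib (u y) (B (suc y) (punchIn r z)) (B (suc y) r) γ p) ⟩
    sumFin (λ y → u y * B (suc y) (punchIn r z) - p * γ * (u y * B (suc y) r))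
      ≡⟨ sumFin-- (λ y → u y * B (suc y) (punchIn r z)) (λ y → p * γ * (u y * B (suc y) r)) ⟩
    T₁ - sumFin (λ y → p * γ * (u y * B (suc y) r))
      ≡⟨ cong (λ t → T₁ - t) (sumFin-*ˡ (p * γ) (λ y → u y * B (suc y) r)) ⟩
    T₁ - p * γ * T₂
      ≡⟨ pivot-cancel {p} {M (punchIn r x) zero} {β} {γ} {T₁} {T₂} h₁ h₂ βγ≡1 ⟩
    idMat x z ∎
    where
    u : Vector ℚ n
    u y = M (punchIn r x) (suc y)
    p T₁ T₂ : ℚ
    p = B zero (punchIn r z)
    T₁ = sumFin (λ y → u y * B (suc y) (punchIn r z))
    T₂ = sumFin (λ y → u y * B (suc y) r)
    distrib : ∀ m b c γ p → m * (b - c * γ * p) ≡ m * b - p * γ * (m * c)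
    distrib = solve-∀ ℚ-ring
    h₁ : p * M (punchIn r x) zero + T₁ ≡ idMat x z
    h₁ = trans (cong (_+ T₁) (*-comm p _)) (trans (MB≡I (punchIn r x) (punchIn r z)) (idMat-punchIn r x z))
    h₂ : β * M (punchIn r x) zero + T₂ ≡ 0ℚ
    h₂ = trans (cong (_+ T₂) (*-comm β _)) (trans (MB≡I (punchIn r x) r) (idMat-≢ (punchInᵢ≢i r x)))

  schurComplement-⊗-minor : ∀ y w → (schurComplement ⊗ minor M r zero) y w ≡ idMat y w
  schurComplement-⊗-minor y w = begin
    sumFin (λ z → schurComplement y z * v z)
      ≡⟨ sumFin-cong (λ z → distrib (B (suc y) (punchIn r z)) c γ (B zero (punchIn r z)) (v z)) ⟩
    sumFin (λ z → B (suc y) (punchIn r z) * v z - c * γ * (B zero (punchIn r z) * v z))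
      ≡⟨ sumFin-- (λ z → B (suc y) (punchIn r z) * v z) (λ z → c * γ * (B zero (punchIn r z) * v z)) ⟩
    V₁ - sumFin (λ z → c * γ * (B zero (punchIn r z) * v z))
      ≡⟨ cong (λ t → V₁ - t) (sumFin-*ˡ (c * γ) (λ z → B zero (punchIn r z) * v z)) ⟩
    V₁ - c * γ * V₂
      ≡⟨ pivot-cancel {c} {M r (suc w)} {β} {γ} {V₁} {V₂} h₁ h₂ βγ≡1 ⟩
    idMat y w ∎
    where
    v : Vector ℚ n
    v z = M (punchIn r z) (suc w)
    c V₁ V₂ : ℚ
    c = B (suc y) r
    V₁ = sumFin (λ z → B (suc y) (punchIn r z) * v z)
    V₂ = sumFin (λ z → B zero (punchIn r z) * v z)
    distrib : ∀ b c γ q m → (b - c * γ * q) * m ≡ b * m - c * γ * (q * m)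
    distrib = solve-∀ ℚ-ring
    h₁ : c * M r (suc w) + V₁ ≡ idMat y w
    h₁ = trans (sym (sumFin-punchIn r (λ t → B (suc y) t * M t (suc w)))) (BM≡I (suc y) (suc w))
    h₂ : β * M r (suc w) + V₂ ≡ 0ℚ
    h₂ = trans (sym (sumFin-punchIn r (λ t → B zero t * M t (suc w)))) (BM≡I zero (suc w))

  det-minor≡0 : det M ≡ 0ℚ → det (minor M r zero) ≡ 0ℚ
  det-minor≡0 detM≡0 = sgn-cancel (toℕ r) (begin
    sgn (toℕ r) * det (minor M r zero) ≡⟨ adj≡minor ⟨
    adj M zero r                       ≡⟨ cramer M B (λ x → MB≡I x r) zero ⟩
    det M * β                          ≡⟨ cong (_* β) detM≡0 ⟩
    0ℚ * β                             ≡⟨ *-zeroˡ β ⟩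
    0ℚ                                 ∎)
    where
    adj≡minor : adj M zero r ≡ sgn (toℕ r) * det (minor M r zero)
    adj≡minor = trans (det-col₀≡basis (setCol M zero (basis r)) r (setCol-col M zero (basis r)))
      (cong (sgn (toℕ r) *_) (det-cong λ x y → setCol-agreeOffCol M zero (basis r) (punchIn r x) (suc y) (λ ())))

invertible⇒det≢0 : {M B : Mat n} → IsInverse M B → det M ≢ 0ℚ
invertible⇒det≢0 {zero} _ ()
invertible⇒det≢0 {suc n} {M} {B} (MB≡I , BM≡I) detM≡0 with inverse-row-nonzero B M BM≡I zero
... | r , β≢0 = invertible⇒det≢0
  (minor-⊗-schurComplement M B MB≡I BM≡I β≢0 , schurComplement-⊗-minor M B MB≡I BM≡I β≢0)
  (det-minor≡0 M B MB≡I BM≡I β≢0 detM≡0)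

square-pos : (b : ℚ) → b ≢ 0ℚ → 0ℚ < b * b
square-pos b b≢0 with ℚ.<-cmp b 0ℚ
... | tri< b<0 _ _ = ℚ.positive⁻¹ (b * b) {{ℚ.neg*neg⇒pos b {{negative b<0}} b {{negative b<0}}}}
... | tri≈ _ b≡0 _ = contradiction b≡0 b≢0
... | tri> _ _ b>0 = ℚ.positive⁻¹ (b * b) {{ℚ.pos*pos⇒pos b {{positive b>0}} b {{positive b>0}}}}

adjInverse : (M : Mat n) → det M ≢ 0ℚ → Mat n
adjInverse M det≢0 x y = 1/_ (det M) {{≢-nonZero det≢0}} * adj M x y

adjInverse-⊗ : (M : Mat n) (det≢0 : det M ≢ 0ℚ) → ∀ x y → (adjInverse M det≢0 ⊗ M) x y ≡ idMat x y
adjInverse-⊗ M det≢0 x y = begin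
  sumFin (λ r → γ * adj M x r * M r y)   ≡⟨ sumFin-cong (λ r → *-assoc γ (adj M x r) (M r y)) ⟩
  sumFin (λ r → γ * (adj M x r * M r y)) ≡⟨ sumFin-*ˡ γ (λ r → adj M x r * M r y) ⟩
  γ * (adj M ⊗ M) x y                    ≡⟨ cong (γ *_) (adj-⊗ M x y) ⟩
  γ * (det M * idMat x y)                ≡⟨ *-assoc γ (det M) (idMat x y) ⟨
  γ * det M * idMat x y                  ≡⟨ cong (_* idMat x y) (ℚ.*-inverseˡ (det M) {{≢-nonZero det≢0}}) ⟩
  1ℚ * idMat x y                         ≡⟨ *-identityˡ (idMat x y) ⟩
  idMat x y                              ∎
  where
  γ : ℚ
  γ = 1/_ (det M) {{≢-nonZero det≢0}}

det-skew-nonneg-step : (M B : Mat (suc (suc n))) → Skew M → (∀ x y → (B ⊗ M) x y ≡ idMat x y) →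
  (∀ k → 0ℚ ≤ det (minor (minor M zero zero) k k)) → 0ℚ ≤ det M
det-skew-nonneg-step M B skew BM≡I minors≥0 with inverse-row-nonzero B M BM≡I zero
... | zero , B₀₀≢0 = contradiction (skew-diag (proj₁ (skew-inverse M B skew BM≡I)) zero) B₀₀≢0
... | suc k , b≢0 = ℚ.*-cancelʳ-≤-pos (b * b) {{positive (square-pos b b≢0)}}
  (subst₂ _≤_ (sym (*-zeroˡ (b * b))) (det-principal-minor₂ M B skewB MB≡I k) (minors≥0 k))
  where
  b : ℚ
  b = B zero (suc k)
  skewB : Skew B
  skewB = proj₁ (skew-inverse M B skew BM≡I)
  MB≡I : ∀ x y → (M ⊗ B) x y ≡ idMat x y
  MB≡I = proj₂ (skew-inverse M B skew BM≡I)

det-skew-nonneg : {M : Mat n} → Skew M → 0ℚ ≤ det M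
det-skew-nonneg {zero} _ = ℚ.nonNegative⁻¹ 1ℚ
det-skew-nonneg {suc zero} {M} skew =
  ℚ.≤-reflexive (sym (det-zero-col zero {M} λ { zero → skew-diag skew zero ; (suc ()) }))
det-skew-nonneg {suc (suc n)} {M} skew with det M ℚ.≟ 0ℚ
... | yes det≡0 = ℚ.≤-reflexive (sym det≡0)
... | no det≢0 = det-skew-nonneg-step M (adjInverse M det≢0) skew (adjInverse-⊗ M det≢0) λ k →
  det-skew-nonneg (λ x y → skew (suc (punchIn k x)) (suc (punchIn k y)))

skew-invertible⇒det>0 : {S B : Mat n} → Skew S → IsInverse S B → 0ℚ < det S
skew-invertible⇒det>0 {S = S} skew inv with ℚ.<-cmp 0ℚ (det S)
... | tri< 0<det _ _ = 0<det
... | tri≈ _ 0≡det _ = contradiction (sym 0≡det) (invertible⇒det≢0 inv)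
... | tri> _ _ det<0 = contradiction (ℚ.≤-<-trans (det-skew-nonneg skew) det<0) (ℚ.<-irrefl refl)

det-skew-update : (S S′ B : Mat n) → Skew S → IsInverse S B → {i j : Fin n} → i ≢ j → (α : ℚ) →
  (∀ x y → y ≢ i → y ≢ j → S′ x y ≡ S x y) →
  (∀ x → S′ x i ≡ S x i + α * basis j x) →
  (∀ x → S′ x j ≡ S x j - α * basis i x) →
  det S′ ≡ det S * ((1ℚ + α * B i j) * (1ℚ + α * B i j))
det-skew-update {n} S S′ B skewS (SB≡I , BS≡I) {i} {j} i≢j α S′-other S′-i S′-j = begin
  det S′                                                          ≡⟨ det-S′ ⟩
  det S₁ + α * det (setCol S₁ i (basis j))                         ≡⟨ cong₂ (λ u v → u + α * v) det-S₁ det-S₁ᵢ ⟩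
  (det S + - α * adj S j i) + α * (adj S i j + - α * det Q)
    ≡⟨ cong₂ (λ u v → (det S + - α * u) + α * v) (cramer S B (λ x → SB≡I x i) j)
             (cong₂ (λ u v → u + - α * v) (cramer S B (λ x → SB≡I x j) i)
                                          (det-setCol-basis-pair S B SB≡I (skew-diag skewB i) j)) ⟩
  (det S + - α * (det S * B j i)) + α * (det S * b + - α * (det S * b * B j i))
    ≡⟨ cong (λ c → (det S + - α * (det S * c)) + α * (det S * b + - α * (det S * b * c))) (skewB j i) ⟩
  (det S + - α * (det S * - b)) + α * (det S * b + - α * (det S * b * - b))
    ≡⟨ complete-square (det S) α b ⟩
  det S * ((1ℚ + α * b) * (1ℚ + α * b)) ∎
  where
  b : ℚ
  b = B i j
  j≢i : j ≢ i
  j≢i = i≢j ∘ sym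
  skewB : Skew B
  skewB = proj₁ (skew-inverse S B skewS BS≡I)
  S₁ Q : Mat n
  S₁ = setCol S′ i (col S i)
  Q = setCol (setCol S i (basis j)) j (basis i)
  S₁~S : AgreeOffCol j S₁ S
  S₁~S x y y≢j with y ≟ i
  ... | yes refl = refl
  ... | no y≢i = S′-other x y y≢i y≢j
  S₁-j : ∀ x → S₁ x j ≡ S x j + - α * basis i x
  S₁-j x = trans (setCol-agreeOffCol S′ i (col S i) x j j≢i)
    (trans (S′-j x) (cong (S x j +_) (ℚ.neg-distribˡ-* α (basis i x))))
  det-S′ : det S′ ≡ det S₁ + α * det (setCol S₁ i (basis j))
  det-S′ = det-add-col i α (basis j) (λ x y y≢i → sym (setCol-agreeOffCol S′ i (col S i) x y y≢i))
    (λ x → trans (S′-i x) (cong (_+ α * basis j x) (sym (setCol-col S′ i (col S i) x))))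
  det-S₁ : det S₁ ≡ det S + - α * adj S j i
  det-S₁ = det-add-col j (- α) (basis i) S₁~S S₁-j
  det-S₁ᵢ : det (setCol S₁ i (basis j)) ≡ adj S i j + - α * det Q
  det-S₁ᵢ = det-add-col j (- α) (basis i) (agreeOffCol-setCol (basis j) S₁~S) λ x →
    trans (setCol-agreeOffCol S₁ i (basis j) x j j≢i)
      (trans (S₁-j x) (cong (_+ - α * basis i x) (sym (setCol-agreeOffCol S i (basis j) x j j≢i))))
  complete-square : ∀ d α b → (d + - α * (d * - b)) + α * (d * b + - α * (d * b * - b)) ≡ d * ((1ℚ + α * b) * (1ℚ + α * b))
  complete-square = solve-∀ ℚ-ring

two : ℚ
two = 1ℚ + 1ℚ

arcSign : Bool → ℚ
arcSign b = if b then 1ℚ else - 1ℚ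

arcSign-not : ∀ b → arcSign (not b) ≡ - arcSign b
arcSign-not true = refl
arcSign-not false = refl

module _ (A : Fin n → Fin n → Bool) where

  seidel-≢ : {x y : Fin n} → x ≢ y → seidel A x y ≡ arcSign (A x y)
  seidel-≢ {x} {y} x≢y with x ≟ y
  ... | yes x≡y = contradiction x≡y x≢y
  ... | no _ = refl

  seidel-skew : IsTournament A → Skew (seidel A)
  seidel-skew (_ , antisym) x y with x ≟ y
  ... | yes refl = sym (cong -_ (seidel-diag x))
    where
    seidel-diag : ∀ x → seidel A x x ≡ 0ℚ
    seidel-diag x with x ≟ x
    ... | yes _ = refl
    ... | no x≢x = contradiction refl x≢x
  ... | no x≢y = begin
    arcSign (A x y)        ≡⟨ cong arcSign (antisym x y x≢y) ⟩
    arcSign (not (A y x))  ≡⟨ arcSign-not (A y x) ⟩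
    - arcSign (A y x)      ≡⟨ cong -_ (seidel-≢ (x≢y ∘ sym)) ⟨
    - seidel A y x         ∎

module _ (A : Fin n → Fin n → Bool) (i j : Fin n) where

  reversal-≡ : {x y : Fin n} → (x ≡ i → y ≢ j) → (x ≡ j → y ≢ i) → reversal A i j x y ≡ A x y
  reversal-≡ {x} {y} h₁ h₂ with x ≟ i | y ≟ j | x ≟ j | y ≟ i
  ... | yes x≡i | yes y≡j | _        | _        = contradiction y≡j (h₁ x≡i)
  ... | _       | _       | yes x≡j  | yes y≡i  = contradiction y≡i (h₂ x≡j)
  ... | yes _   | no _    | no _     | _        = refl
  ... | yes _   | no _    | yes _    | no _     = refl
  ... | no _    | _       | no _     | _        = refl
  ... | no _    | _       | yes _    | no _     = refl

  reversal-ij : reversal A i j i j ≡ not (A i j)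
  reversal-ij with i ≟ i | j ≟ j
  ... | yes _ | yes _ = refl
  ... | no i≢i | _ = contradiction refl i≢i
  ... | _ | no j≢j = contradiction refl j≢j

  reversal-ji : reversal A i j j i ≡ not (A j i)
  reversal-ji with j ≟ i | i ≟ j | j ≟ j | i ≟ i
  ... | yes _ | yes _ | _ | _ = refl
  ... | yes _ | no _ | yes _ | yes _ = refl
  ... | no _ | _ | yes _ | yes _ = refl
  ... | _ | _ | no j≢j | _ = contradiction refl j≢j
  ... | _ | _ | _ | no i≢i = contradiction refl i≢i

module _ {A : Fin n → Fin n → Bool} (tournament : IsTournament A) {i j : Fin n} (i≢j : i ≢ j) (ij-arc : A i j ≡ true) where

  private
    S S′ : Mat n
    S = seidel A
    S′ = seidel (reversal A i j)
    ji-not-arc : A j i ≡ false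
    ji-not-arc = trans (proj₂ tournament j i (i≢j ∘ sym)) (cong not ij-arc)

  seidel-reversal-other : ∀ x y → y ≢ i → y ≢ j → S′ x y ≡ S x y
  seidel-reversal-other x y y≢i y≢j =
    cong (λ b → if does (x ≟ y) then 0ℚ else arcSign b) (reversal-≡ A i j (λ _ → y≢j) (λ _ → y≢i))

  seidel-reversal-i : ∀ x → S′ x i ≡ S x i + two * basis j x
  seidel-reversal-i x = by-cases (x ≟ j)
    where
    by-cases : Dec (x ≡ j) → S′ x i ≡ S x i + two * basis j x
    by-cases (yes refl) = begin
      S′ j i                       ≡⟨ seidel-≢ (reversal A i j) (i≢j ∘ sym) ⟩
      arcSign (reversal A i j j i) ≡⟨ cong arcSign (trans (reversal-ji A i j) (cong not ji-not-arc)) ⟩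
      arcSign false + two * 1ℚ     ≡⟨ cong₂ (λ b e → arcSign b + two * e) ji-not-arc (idMat-diag j) ⟨
      arcSign (A j i) + two * basis j j ≡⟨ cong (_+ two * basis j j) (seidel-≢ A (i≢j ∘ sym)) ⟨
      S j i + two * basis j j      ∎
    by-cases (no x≢j) = begin
      S′ x i                       ≡⟨ seidel-reversal-other′ ⟩
      S x i                        ≡⟨ +-identityʳ (S x i) ⟨
      S x i + two * 0ℚ             ≡⟨ cong (λ e → S x i + two * e) (idMat-≢ x≢j) ⟨
      S x i + two * basis j x      ∎
      where
      seidel-reversal-other′ : S′ x i ≡ S x i
      seidel-reversal-other′ = cong (λ b → if does (x ≟ i) then 0ℚ else arcSign b)
        (reversal-≡ A i j (λ _ → i≢j) (λ x≡j → contradiction x≡j x≢j))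

  seidel-reversal-j : ∀ x → S′ x j ≡ S x j - two * basis i x
  seidel-reversal-j x = by-cases (x ≟ i)
    where
    by-cases : Dec (x ≡ i) → S′ x j ≡ S x j - two * basis i x
    by-cases (yes refl) = begin
      S′ i j                       ≡⟨ seidel-≢ (reversal A i j) i≢j ⟩
      arcSign (reversal A i j i j) ≡⟨ cong arcSign (trans (reversal-ij A i j) (cong not ij-arc)) ⟩
      arcSign true - two * 1ℚ      ≡⟨ cong₂ (λ b e → arcSign b - two * e) ij-arc (idMat-diag i) ⟨
      arcSign (A i j) - two * basis i i ≡⟨ cong (_- two * basis i i) (seidel-≢ A i≢j) ⟨
      S i j - two * basis i i      ∎
    by-cases (no x≢i) = begin
      S′ x j                       ≡⟨ seidel-reversal-other′ ⟩
      S x j                        ≡⟨ +-identityʳ (S x j) ⟨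
      S x j - two * 0ℚ             ≡⟨ cong (λ e → S x j - two * e) (idMat-≢ x≢i) ⟨
      S x j - two * basis i x      ∎
      where
      seidel-reversal-other′ : S′ x j ≡ S x j
      seidel-reversal-other′ = cong (λ b → if does (x ≟ j) then 0ℚ else arcSign b)
        (reversal-≡ A i j (λ x≡i → contradiction x≡i x≢i) (λ _ → i≢j ∘ sym))

square-expand : ∀ b → (1ℚ + two * b) * (1ℚ + two * b) ≡ 1ℚ + two * two * (b * (b + 1ℚ))
square-expand = solve-∀ ℚ-ring

b[b+1]>0 : {b : ℚ} → 0ℚ < b ⊎ b < - 1ℚ → 0ℚ < b * (b + 1ℚ)
b[b+1]>0 {b} (inj₁ b>0) = ℚ.positive⁻¹ _ {{ℚ.pos*pos⇒pos b {{positive b>0}} (b + 1ℚ) {{positive b+1>0}}}}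
  where
  b+1>0 : 0ℚ < b + 1ℚ
  b+1>0 = ℚ.+-mono-< b>0 (ℚ.positive⁻¹ 1ℚ)
b[b+1]>0 {b} (inj₂ b<-1) = ℚ.positive⁻¹ _ {{ℚ.neg*neg⇒pos b {{negative b<0}} (b + 1ℚ) {{negative b+1<0}}}}
  where
  b<0 : b < 0ℚ
  b<0 = ℚ.<-trans b<-1 (ℚ.negative⁻¹ (- 1ℚ))
  b+1<0 : b + 1ℚ < 0ℚ
  b+1<0 = ℚ.+-monoˡ-< 1ℚ b<-1

b[b+1]<0 : {b : ℚ} → - 1ℚ < b → b < 0ℚ → b * (b + 1ℚ) < 0ℚ
b[b+1]<0 {b} b>-1 b<0 = ℚ.negative⁻¹ _ {{ℚ.neg*pos⇒neg b {{negative b<0}} (b + 1ℚ) {{positive b+1>0}}}}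
  where
  b+1>0 : 0ℚ < b + 1ℚ
  b+1>0 = ℚ.+-monoˡ-< 1ℚ b>-1

one<square : {b : ℚ} → 0ℚ < b ⊎ b < - 1ℚ → 1ℚ < (1ℚ + two * b) * (1ℚ + two * b)
one<square {b} h = subst₂ _<_ (+-identityʳ 1ℚ) (sym (square-expand b)) (ℚ.+-monoʳ-< 1ℚ four-t>0)
  where
  four-t>0 : 0ℚ < two * two * (b * (b + 1ℚ))
  four-t>0 = ℚ.positive⁻¹ _ {{ℚ.pos*pos⇒pos (two * two) (b * (b + 1ℚ)) {{positive (b[b+1]>0 h)}}}}

square<one : {b : ℚ} → - 1ℚ < b → b < 0ℚ → (1ℚ + two * b) * (1ℚ + two * b) < 1ℚ
square<one {b} b>-1 b<0 = subst₂ _<_ (sym (square-expand b)) (+-identityʳ 1ℚ) (ℚ.+-monoʳ-< 1ℚ four-t<0)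
  where
  four-t<0 : two * two * (b * (b + 1ℚ)) < 0ℚ
  four-t<0 = ℚ.negative⁻¹ _ {{ℚ.pos*neg⇒neg (two * two) (b * (b + 1ℚ)) {{negative (b[b+1]<0 b>-1 b<0)}}}}

square≡one : {b : ℚ} → b ≡ 0ℚ ⊎ b ≡ - 1ℚ → (1ℚ + two * b) * (1ℚ + two * b) ≡ 1ℚ
square≡one (inj₁ refl) = refl
square≡one (inj₂ refl) = refl

lemma2p4 : (n : ℕ) (A : Fin n → Fin n → Bool) → IsTournament A →
    (B : Mat n) → IsInverse (seidel A) B →
    (i j : Fin n) → i ≢ j → A i j ≡ true →
    (det (seidel (reversal A i j))
       ≡ det (seidel A) * ((1ℚ + (1ℚ + 1ℚ) * B i j) * (1ℚ + (1ℚ + 1ℚ) * B i j)))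
    × ((0ℚ < B i j ⊎ B i j < - 1ℚ) → det (seidel A) < det (seidel (reversal A i j)))
    × ((B i j ≡ 0ℚ ⊎ B i j ≡ - 1ℚ) → det (seidel (reversal A i j)) ≡ det (seidel A))
    × ((- 1ℚ < B i j × B i j < 0ℚ) → det (seidel (reversal A i j)) < det (seidel A))
lemma2p4 n A tournament B inv i j i≢j ij-arc = det-identity , increase , unchanged , decrease
  where
  S S′ : Mat n
  S = seidel A
  S′ = seidel (reversal A i j)
  D : ℚ
  D = det S
  det-identity : det S′ ≡ D * ((1ℚ + two * B i j) * (1ℚ + two * B i j))
  det-identity = det-skew-update S S′ B (seidel-skew A tournament) inv i≢j two
    (seidel-reversal-other tournament i≢j ij-arc) (seidel-reversal-i tournament i≢j ij-arc)
    (seidel-reversal-j tournament i≢j ij-arc)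
  scale : {p q : ℚ} → p < q → D * p < D * q
  scale = ℚ.*-monoʳ-<-pos D {{positive (skew-invertible⇒det>0 (seidel-skew A tournament) inv)}}
  increase : 0ℚ < B i j ⊎ B i j < - 1ℚ → D < det S′
  increase h = subst₂ _<_ (*-identityʳ D) (sym det-identity) (scale (one<square h))
  unchanged : B i j ≡ 0ℚ ⊎ B i j ≡ - 1ℚ → det S′ ≡ D
  unchanged h = trans det-identity (trans (cong (D *_) (square≡one h)) (*-identityʳ D))
  decrease : - 1ℚ < B i j × B i j < 0ℚ → det S′ < D
  decrease (h₁ , h₂) = subst₂ _<_ (sym det-identity) (*-identityʳ D) (scale (square<one h₁ h₂))
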